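{- Let $\Gamma$ be a thick partial geometry $\mathsf{pg}(s,t,\alpha)$, and consider the association scheme of its collinearity graph with minimal idempotents $E_0,E_1,E_2$ ordered as described in the context. Then for $i\in\{1,2\}$, the Krein parameter $q_{ii}^i$ is zero if and only if $i=2$, \[ \alpha=\frac{s^2-t-1+\sqrt{t(t+1-s^2)}}{s-1}, \] and $t\ge s^2$. Moreover, in this case, $\alpha=1$ if and only if $t=s^2$.
   Context: A partial geometry $\mathsf{pg}(s,t,\alpha)$ is a point–line incidence structure in which any two distinct points lie on at most one common line, every line contains $s+1$ points, every point lies on $t+1$ lines, and for every point $P$ and line $\ell$ not incident with $P$ there are exactly $\alpha$ points on $\ell$ collinear with $P$. It is thick if $s,t>1$. Its collinearity graph (vertices the points, adjacency being distinct and collinear) is strongly regular with $(s+1)(st+\alpha)/\alpha$ vertices, and it gives a 2-class association scheme. Its minimal idempotents are ordered $E_0=\frac1{|\Omega|}J$, $E_1$, $E_2$ so that the matrix of eigenvalues ($P_{i\ell}$ = eigenvalue of the $\ell$-th adjacency matrix $A_\ell$ on the column space of $E_i$, with $A_1$ the collinearity adjacency matrix and $A_2$ the non-collinearity one) is \[ P=\begin{bmatrix}1&s(t+1)&\tfrac{st}{\alpha}(s+1-\alpha)\\ 1&s-\alpha&\alpha-s-1\\ 1&-t-1&t\end{bmatrix}. \] Krein parameters are defined by $E_i\circ E_j=\frac{1}{|\Omega|}\sum_h q_{ij}^hE_h$ ($\circ$ the entrywise product); equivalently $q_{ij}^h=\frac{m_im_j}{|\Omega|}\sum_{\ell}\frac{P_{i\ell}P_{j\ell}P_{h\ell}}{k_\ell^2}$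 with $k_\ell=P_{0\ell}$ and $m_i$ the rank of $E_i$. -}

module Defs where

open import Data.Nat as ℕ using (ℕ; suc)
open import Data.Integer as ℤ using (ℤ)
open import Data.Bool using (Bool; true; false; _∧_)
open import Data.Fin using (Fin; zero; suc)
open import Data.List using (List; length; filterᵇ)
open import Data.Bool.ListAction using (any)
open import Data.List.Base using (allFin)
open import Data.Rational using (ℚ; 0ℚ; 1ℚ; _+_; _*_; _-_; _÷_; _/_; ≢-nonZero)
open import Data.Rational.Properties using (_≟_)
open import Relation.Nullary using (yes; no)
open import Relation.Binary.PropositionalEquality using (_≡_; _≢_)

countᵇ : (n : ℕ) → (Fin n → Bool) → ℕ
countᵇ n f = length (filterᵇ f (allFin n))

record PartialGeometry (s t α : ℕ) : Set where
  field
    v b : ℕ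
    I : Fin v → Fin b → Bool
    somePoint : Fin v
  -- two points are collinear iff some line contains both
  -- (in particular every point is collinear with itself)
  collinear : Fin v → Fin v → Bool
  collinear p q = any (λ l → I p l ∧ I q l) (allFin b)
  field
    atMostOneLine : ∀ (p q : Fin v) (l m : Fin b) → p ≢ q →
      I p l ≡ true → I q l ≡ true → I p m ≡ true → I q m ≡ true → l ≡ m
    linesSize : ∀ (l : Fin b) → countᵇ v (λ p → I p l) ≡ suc s
    pointDegree : ∀ (p : Fin v) → countᵇ b (λ l → I p l) ≡ suc t
    alphaAxiom : ∀ (p : Fin v) (l : Fin b) → I p l ≡ false →
      countᵇ v (λ q → I q l ∧ collinear p q) ≡ α

ℕ→ℚ : ℕ → ℚ
ℕ→ℚ n = ℤ.+ n / 1

-- division, total (returns 0 when dividing by 0; never used at 0 under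
-- the hypotheses of the theorem)
_÷?_ : ℚ → ℚ → ℚ
p ÷? q with q ≟ 0ℚ
... | yes _ = 0ℚ
... | no q≢0 = _÷_ p q {{≢-nonZero q≢0}}

infixl 7 _÷?_

sum3 : (Fin 3 → ℚ) → ℚ
sum3 f = f zero + f (suc zero) + f (suc (suc zero))

-- The eigenmatrix of the association scheme of the collinearity graph,
-- with E₀, E₁, E₂ ordered as in the paper.

module Scheme (s t α N : ℕ) where
  S T A : ℚ
  S = ℕ→ℚ s
  T = ℕ→ℚ t
  A = ℕ→ℚ α

  -- number of points |Ω|
  Ω : ℚ
  Ω = ℕ→ℚ N

  P : Fin 3 → Fin 3 → ℚ
  P zero zero = 1ℚ
  P zero (suc zero) = S * (T + 1ℚ)
  P zero (suc (suc zero)) = (S * T) ÷? A * (S + 1ℚ - A)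
  P (suc zero) zero = 1ℚ
  P (suc zero) (suc zero) = S - A
  P (suc zero) (suc (suc zero)) = A - S - 1ℚ
  P (suc (suc zero)) zero = 1ℚ
  P (suc (suc zero)) (suc zero) = 0ℚ - T - 1ℚ
  P (suc (suc zero)) (suc (suc zero)) = T

  k : Fin 3 → ℚ
  k ℓ = P zero ℓ

  -- multiplicities m_i = rank E_i, via the orthogonality relation
  -- m_i = |Ω| / Σ_ℓ P_{iℓ}² / k_ℓ
  m : Fin 3 → ℚ
  m i = Ω ÷? sum3 (λ ℓ → P i ℓ * P i ℓ ÷? k ℓ)

  q : Fin 3 → Fin 3 → Fin 3 → ℚ
  q i j h = (m i * m j ÷? Ω) * sum3 (λ ℓ → P i ℓ * P j ℓ * P h ℓ ÷? (k ℓ * k ℓ))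

krein : ∀ {s t α} → PartialGeometry s t α → Fin 3 → Fin 3 → Fin 3 → ℚ
krein {s} {t} {α} Γ = Scheme.q s t α (PartialGeometry.v Γ)

{-# OPTIONS --safe #-}
-- Since m i ≠ 0, q i i i vanishes iff τ i = Σ_ℓ P_iℓ³ / k_ℓ² does.  Clearing
-- denominators, τ₁ is a positive multiple of
--   s²t²(t+1)² + t²(s-α)³ - (s+1-α)(t+1)²α²,
-- which is positive because 1 ≤ α ≤ min(s, t+1) in a partial geometry whose
-- collinearity graph is not complete; and τ₂ is a positive multiple of
--   g = (s²-t-1)(s+1-α)² + tα².
-- If s² > t every term of g is positive, so g = 0 forces s² ≤ t.  Completing the
-- square in α gives (s-1)g = (s+1)(r² - t(t+1-s²)) with r = (s-1)α - (s²-t-1),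
-- so g = 0 says exactly that α is the stated root.  When t = s² the root is r = s,
-- i.e. α = 1; conversely α = 1 turns r² = t(t+1-s²) into (s-1)²(s²-t) = 0.
module Submission where

module Counting where
  open import Data.Bool using (Bool; true; false; _∧_; _∨_)
  open import Data.Bool.ListAction using (any)
  open import Data.Bool.Properties using (T-≡; not-¬)
  open import Data.List using (List; []; _∷_; length; filterᵇ; map)
  open import Data.List.Membership.Propositional using (_∈_; lose)
  open import Data.List.Properties using (filter-some)
  open import Data.List.Membership.Propositional.Properties using (∈-filter⁻)
  open import Data.List.Relation.Unary.Any using (here; there)
  open import Data.List.Relation.Unary.AllPairs using (_∷_)
  open import Data.List.Relation.Unary.All using (_∷_)
  open import Data.List.Relation.Unary.Unique.Propositional using (Unique)
  import Data.List.Relation.Unary.Unique.Propositional.Properties as Unique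
  open import Data.Nat using (ℕ; _+_; _≤_; _<_; z≤n; s≤s)
  open import Data.Nat.ListAction using (sum)
  open import Data.Nat.Properties using (≤-pred; _≤?_; ≤-trans; m≤n⇒m≤1+n; +-mono-≤; +-monoʳ-≤; +-suc; n≤1+n; ≤-reflexive; ≰⇒>)
  open import Data.Product using (∃; ∃₂; _×_; _,_; proj₁; proj₂)
  open import Function using (_∘_; Equivalence)
  open import Relation.Binary.Definitions using (DecidableEquality)
  open import Relation.Binary.PropositionalEquality using (_≡_; _≢_; refl; sym)
  open import Relation.Nullary using (yes; no; T?)
  open import Data.Empty using (⊥-elim)

  ∧-true : ∀ {a b} → a ∧ b ≡ true → a ≡ true × b ≡ true
  ∧-true {true} b≡true = refl , b≡true

  count : {A : Set} → (A → Bool) → List A → ℕ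
  count f xs = length (filterᵇ f xs)

  module _ {A : Set} where

    count-witness : ∀ (f : A → Bool) xs → 0 < count f xs → ∃ λ x → f x ≡ true
    count-witness f (x ∷ xs) pos with f x in fx
    ... | true  = x , fx
    ... | false = count-witness f xs pos

    count-pos : ∀ (f : A → Bool) {x xs} → x ∈ xs → f x ≡ true → 0 < count f xs
    count-pos f x∈xs fx = filter-some (T? ∘ f) (lose x∈xs (Equivalence.from T-≡ fx))

    count-mono : ∀ {f g : A → Bool} → (∀ x → f x ≡ true → g x ≡ true) → ∀ xs → count f xs ≤ count g xs
    count-mono f⇒g [] = z≤n
    count-mono {f} {g} f⇒g (x ∷ xs) with f x in fx | g x in gx
    ... | true  | true  = s≤s (count-mono f⇒g xs)
    ... | true  | false = ⊥-elim (not-¬ (f⇒g x fx) gx)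
    ... | false | true  = m≤n⇒m≤1+n (count-mono f⇒g xs)
    ... | false | false = count-mono f⇒g xs

    count-∧-< : ∀ (f g : A → Bool) {x xs} → x ∈ xs → f x ≡ true → g x ≡ false →
                count (λ y → f y ∧ g y) xs < count f xs
    count-∧-< f g {xs = y ∷ xs} (here refl) fx gx rewrite fx | gx =
      s≤s (count-mono (λ _ → proj₁ ∘ ∧-true) xs)
    count-∧-< f g {xs = y ∷ xs} (there x∈xs) fx gx with f y | g y
    ... | true  | true  = s≤s (count-∧-< f g x∈xs fx gx)
    ... | true  | false = m≤n⇒m≤1+n (count-∧-< f g x∈xs fx gx)
    ... | false | _     = count-∧-< f g x∈xs fx gx

    count-false : (xs : List A) → count (λ _ → false) xs ≡ 0
    count-false []       = refl
    count-false (_ ∷ xs) = count-false xs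

    count-∨ : ∀ (f g : A → Bool) xs → count (λ x → f x ∨ g x) xs ≤ count f xs + count g xs
    count-∨ f g [] = z≤n
    count-∨ f g (x ∷ xs) with f x | g x
    ... | true  | true  = s≤s (≤-trans (count-∨ f g xs) (+-monoʳ-≤ (count f xs) (n≤1+n _)))
    ... | true  | false = s≤s (count-∨ f g xs)
    ... | false | true  = ≤-trans (s≤s (count-∨ f g xs)) (≤-reflexive (sym (+-suc _ _)))
    ... | false | false = count-∨ f g xs

    count-any : ∀ {B : Set} (h : B → A → Bool) ms xs →
                count (λ x → any (λ m → h m x) ms) xs ≤ sum (map (λ m → count (h m) xs) ms)
    count-any h []       xs = ≤-reflexive (count-false xs)
    count-any h (m ∷ ms) xs = ≤-trans (count-∨ (h m) _ xs) (+-monoʳ-≤ (count (h m) xs) (count-any h ms xs))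

    sum-count-≤ : ∀ {B : Set} (g : B → Bool) (h : B → A → Bool) xs →
                  (∀ m → g m ≡ true → count (h m) xs ≤ 1) →
                  ∀ ms → sum (map (λ m → count (λ x → g m ∧ h m x) xs) ms) ≤ count g ms
    sum-count-≤ g h xs h≤1 [] = z≤n
    sum-count-≤ g h xs h≤1 (m ∷ ms) with g m in gm
    ... | true  = +-mono-≤ (h≤1 m gm) (sum-count-≤ g h xs h≤1 ms)
    ... | false = +-mono-≤ (≤-reflexive (count-false xs)) (sum-count-≤ g h xs h≤1 ms)

    count-distinct : ∀ (f : A → Bool) {xs} → Unique xs → 2 ≤ count f xs →
                     ∃₂ λ x y → x ≢ y × f x ≡ true × f y ≡ true
    count-distinct f {xs} unique 2≤count
      with filterᵇ f xs | Unique.filter⁺ (T? ∘ f) unique | (λ {v} → proj₂ ∘ ∈-filter⁻ (T? ∘ f) {v} {xs})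
    count-distinct f unique () | [] | _ | _
    count-distinct f unique (s≤s ()) | _ ∷ [] | _ | _
    ... | x ∷ y ∷ _ | (x≢y ∷ _) ∷ _ | sat =
      x , y , x≢y , Equivalence.to T-≡ (sat (here refl)) , Equivalence.to T-≡ (sat (there (here refl)))

    count-≤1 : ∀ (f : A → Bool) {xs} → Unique xs → (∀ {x y} → f x ≡ true → f y ≡ true → x ≡ y) →
               count f xs ≤ 1
    count-≤1 f {xs} unique f-injective with 2 ≤? count f xs
    ... | no  ≱2 = ≤-pred (≰⇒> ≱2)
    ... | yes ≥2 with x , y , x≢y , fx , fy ← count-distinct f unique ≥2 = ⊥-elim (x≢y (f-injective fx fy))

    count-avoid : DecidableEquality A → ∀ (f : A → Bool) {xs} → Unique xs → 2 ≤ count f xs →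
                  ∀ p → ∃ λ x → f x ≡ true × x ≢ p
    count-avoid _≟_ f unique ≥2 p with x , y , x≢y , fx , fy ← count-distinct f unique ≥2 | x ≟ p
    ... | yes refl = y , fy , x≢y ∘ sym
    ... | no  x≢p  = x , fx , x≢p

module PartialGeometryBounds where
  open Counting
  open import Defs
  open import Data.Bool using (true; false; _∧_)
  open import Data.Bool.ListAction using (any)
  open import Data.Bool.Properties using (T-≡; not-¬)
  open import Data.Fin using (Fin; _≟_)
  open import Data.Fin.Properties using (¬Fin0)
  open import Data.List using (allFin; map)
  open import Data.Nat.ListAction using (sum)
  open import Data.List.Membership.Propositional using (lose)
  open import Data.List.Membership.Propositional.Properties using (∈-allFin)
  open import Data.List.Relation.Unary.Any.Properties using (any⁺)
  open import Data.List.Relation.Unary.Unique.Propositional.Properties using (allFin⁺)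
  open import Data.Nat using (suc; _≤_; _<_; z<s; s≤s)
  open import Data.Nat.Properties using (≤-pred; module ≤-Reasoning)
  open import Data.Product using (∃; _×_; _,_)
  open import Data.Empty using (⊥-elim)
  open import Function using (_∘_; Equivalence)
  open import Relation.Binary.PropositionalEquality using (_≡_; _≢_; refl; sym; cong₂; subst; subst₂)
  open import Relation.Nullary using (yes; no)

  module _ {s t α} (Γ : PartialGeometry s t α) where
    open PartialGeometry Γ

    line-through : ∀ p → ∃ λ l → I p l ≡ true
    line-through p = count-witness (I p) (allFin b) (subst (0 <_) (sym (pointDegree p)) z<s)

    collinear-on : ∀ {p q l} → I p l ≡ true → I q l ≡ true → collinear p q ≡ true
    collinear-on {p} {q} {l} pl ql = Equivalence.to T-≡
      (any⁺ (λ m → I p m ∧ I q m) (lose (∈-allFin l) (Equivalence.from T-≡ (cong₂ _∧_ pl ql))))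

    noncollinear⇒off-line : ∀ {p q} → collinear p q ≡ false → ∃ λ l → I q l ≡ true × I p l ≡ false
    noncollinear⇒off-line {p} {q} p≁q with l , ql ← line-through q | I p l in pl
    ... | false = l , ql , pl
    ... | true  = ⊥-elim (not-¬ (collinear-on pl ql) p≁q)

    distinct-lines-meet-≤1 : ∀ {l m} → l ≢ m → countᵇ v (λ x → I x l ∧ I x m) ≤ 1
    distinct-lines-meet-≤1 {l} {m} l≢m = count-≤1 _ (allFin⁺ v) meet-unique
      where
      meet-unique : ∀ {x y} → I x l ∧ I x m ≡ true → I y l ∧ I y m ≡ true → x ≡ y
      meet-unique {x} {y} x∈l∩m y∈l∩m with x ≟ y | ∧-true x∈l∩m | ∧-true y∈l∩m
      ... | yes x≡y | _ | _ = x≡y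
      ... | no  x≢y | xl , xm | yl , ym = ⊥-elim (l≢m (atMostOneLine x y l m x≢y xl yl xm ym))

    1≤α : 1 ≤ s → 1 ≤ t → 1 ≤ α
    1≤α 1≤s 1≤t
      with p ← somePoint
      with l , pl ← line-through p
      with q , ql , q≢p ← count-avoid _≟_ (λ x → I x l) (allFin⁺ v) (subst (2 ≤_) (sym (linesSize l)) (s≤s 1≤s)) p
      with m , qm , m≢l ← count-avoid _≟_ (I q) (allFin⁺ b) (subst (2 ≤_) (sym (pointDegree q)) (s≤s 1≤t)) l
      with I p m in pm
    ... | true  = ⊥-elim (m≢l (sym (atMostOneLine p q l m (q≢p ∘ sym) pl ql pm qm)))
    ... | false = subst (1 ≤_) (alphaAxiom p m pm) (count-pos _ (∈-allFin q) (cong₂ _∧_ qm (collinear-on pl ql)))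

    α≤s : ∀ {p q} → collinear p q ≡ false → α ≤ s
    α≤s {p} {q} p≁q with l , ql , pl ← noncollinear⇒off-line p≁q =
      ≤-pred (subst₂ _<_ (alphaAxiom p l pl) (linesSize l) (count-∧-< (λ x → I x l) (collinear p) (∈-allFin q) ql p≁q))

    α≤1+t : ∀ {p l} → I p l ≡ false → α ≤ suc t
    α≤1+t {p} {l} pl = begin
      α                                                                       ≡⟨ alphaAxiom p l pl ⟨
      countᵇ v (λ x → I x l ∧ collinear p x)                                  ≤⟨ count-mono via-line (allFin v) ⟩
      countᵇ v (λ x → any (λ m → I p m ∧ (I x l ∧ I x m)) (allFin b))         ≤⟨ count-any _ (allFin b) (allFin v) ⟩
      sum (map (λ m → countᵇ v (λ x → I p m ∧ (I x l ∧ I x m))) (allFin b))   ≤⟨ sum-count-≤ (I p) _ (allFin v) meet≤1 (allFin b) ⟩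
      countᵇ b (I p)                                                          ≡⟨ pointDegree p ⟩
      suc t                                                                   ∎
      where
      open ≤-Reasoning
      via-line : ∀ x → I x l ∧ collinear p x ≡ true → any (λ m → I p m ∧ (I x l ∧ I x m)) (allFin b) ≡ true
      via-line x h with I x l
      ... | true = h
      meet≤1 : ∀ m → I p m ≡ true → countᵇ v (λ x → I x l ∧ I x m) ≤ 1
      meet≤1 m pm = distinct-lines-meet-≤1 λ { refl → not-¬ pm pl }

    v≢0 : v ≢ 0
    v≢0 v≡0 = ¬Fin0 (subst Fin v≡0 somePoint)

module RationalArithmetic where
  open import Defs
  open import Data.Rational
  open import Data.Rational.Properties
  open import Data.Maybe using (Maybe; just; nothing)
  open import Data.Empty using (⊥-elim)
  open import Level using (0ℓ)
  open import Relation.Binary.PropositionalEquality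
  open import Relation.Nullary using (yes; no)
  open import Relation.Nullary.Decidable using (decidable-stable)
  import Algebra.Properties.Group as GroupProperties
  open import Algebra.Apartness.Properties.HeytingCommutativeRing heytingCommutativeRing using (x#0y#0→xy#0)
  import Tactic.RingSolver.Core.AlmostCommutativeRing as ACR
  open import Tactic.RingSolver using (solve-∀)

  ringℚ : ACR.AlmostCommutativeRing 0ℓ 0ℓ
  ringℚ = ACR.fromCommutativeRing +-*-commutativeRing 0≟
    where
    0≟ : ∀ x → Maybe (0ℚ ≡ x)
    0≟ x with 0ℚ ≟ x
    ... | yes 0≡x = just 0≡x
    ... | no  _   = nothing

  x-y≡0⇒x≡y : ∀ {x y} → x - y ≡ 0ℚ → x ≡ y
  x-y≡0⇒x≡y = GroupProperties.x∙y⁻¹≈ε⇒x≈y +-0-group _ _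

  x*y≢0 : ∀ {x y} → x ≢ 0ℚ → y ≢ 0ℚ → x * y ≢ 0ℚ
  x*y≢0 = x#0y#0→xy#0

  x*y≡0⇒y≡0 : ∀ {x y} → x ≢ 0ℚ → x * y ≡ 0ℚ → y ≡ 0ℚ
  x*y≡0⇒y≡0 {y = y} x≢0 xy≡0 = decidable-stable (y ≟ 0ℚ) λ y≢0 → x*y≢0 x≢0 y≢0 xy≡0

  x÷?y*y≡x : ∀ x {y} → y ≢ 0ℚ → x ÷? y * y ≡ x
  x÷?y*y≡x x {y} y≢0 with y ≟ 0ℚ
  ... | yes y≡0 = ⊥-elim (y≢0 y≡0)
  ... | no  _   = begin
    x * 1/ y * y   ≡⟨ *-assoc x (1/ y) y ⟩
    x * (1/ y * y) ≡⟨ cong (x *_) (*-inverseˡ y) ⟩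
    x * 1ℚ         ≡⟨ *-identityʳ x ⟩
    x              ∎
    where
    open ≡-Reasoning
    instance
      y-nonZero : NonZero y
      y-nonZero = ≢-nonZero y≢0

  x*z≡y⇒x≡y÷?z : ∀ {x y z} → z ≢ 0ℚ → x * z ≡ y → x ≡ y ÷? z
  x*z≡y⇒x≡y÷?z {x} {y} {z} z≢0 refl with z ≟ 0ℚ
  ... | yes z≡0 = ⊥-elim (z≢0 z≡0)
  ... | no  _   = begin
    x                ≡⟨ *-identityʳ x ⟨
    x * 1ℚ           ≡⟨ cong (x *_) (*-inverseʳ z) ⟨
    x * (z * 1/ z)   ≡⟨ *-assoc x z (1/ z) ⟨
    x * z * 1/ z     ∎
    where
    open ≡-Reasoning
    instance
      z-nonZero : NonZero z
      z-nonZero = ≢-nonZero z≢0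

  x÷?y≢0 : ∀ {x y} → x ≢ 0ℚ → y ≢ 0ℚ → x ÷? y ≢ 0ℚ
  x÷?y≢0 {x} {y} x≢0 y≢0 x÷?y≡0 = x≢0 (begin
    x           ≡⟨ x÷?y*y≡x x y≢0 ⟨
    x ÷? y * y  ≡⟨ cong (_* y) x÷?y≡0 ⟩
    0ℚ * y      ≡⟨ *-zeroˡ y ⟩
    0ℚ          ∎)
    where open ≡-Reasoning

  fractions-cleared : ∀ a b c v {u w} → u ≢ 0ℚ → w ≢ 0ℚ →
                      (a + b ÷? u + c ÷? w) * (u * (w * v)) ≡ a * (u * (w * v)) + b * (w * v) + c * u * v
  fractions-cleared a b c v {u} {w} u≢0 w≢0 = begin
    (a + b ÷? u + c ÷? w) * (u * (w * v))                   ≡⟨ distribute a (b ÷? u) (c ÷? w) u w v ⟩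
    a * (u * (w * v)) + b ÷? u * u * (w * v) + c ÷? w * w * u * v
      ≡⟨ cong₂ (λ b′ c′ → a * (u * (w * v)) + b′ * (w * v) + c′ * u * v) (x÷?y*y≡x b u≢0) (x÷?y*y≡x c w≢0) ⟩
    a * (u * (w * v)) + b * (w * v) + c * u * v             ∎
    where
    open ≡-Reasoning
    distribute : ∀ a p q u w v → (a + p + q) * (u * (w * v)) ≡ a * (u * (w * v)) + p * u * (w * v) + q * w * u * v
    distribute = solve-∀ ringℚ

module NaturalEmbedding where
  open import Defs
  open import Data.Nat as ℕ using (ℕ)
  open import Data.Integer as ℤ using (+_)
  import Data.Integer.Properties as ℤ
  import Data.Nat.Coprimality as Coprime
  open import Data.Rational
  open import Data.Rational.Properties
  open import Relation.Binary.PropositionalEquality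

  private
    ℕ→ℚ-mkℚ : ∀ n → ℕ→ℚ n ≡ mkℚ (+ n) 0 (Coprime.sym (Coprime.1-coprimeTo n))
    ℕ→ℚ-mkℚ n = normalize-coprime (Coprime.sym (Coprime.1-coprimeTo n))

  ℕ→ℚ-+ : ∀ m n → ℕ→ℚ (m ℕ.+ n) ≡ ℕ→ℚ m + ℕ→ℚ n
  ℕ→ℚ-+ m n rewrite ℕ→ℚ-mkℚ m | ℕ→ℚ-mkℚ n =
    cong (_/ 1) (sym (cong₂ ℤ._+_ (ℤ.*-identityʳ (+ m)) (ℤ.*-identityʳ (+ n))))

  ℕ→ℚ-* : ∀ m n → ℕ→ℚ (m ℕ.* n) ≡ ℕ→ℚ m * ℕ→ℚ n
  ℕ→ℚ-* m n rewrite ℕ→ℚ-mkℚ m | ℕ→ℚ-mkℚ n = cong (_/ 1) (ℤ.pos-* m n)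

  ℕ→ℚ-injective : ∀ {m n} → ℕ→ℚ m ≡ ℕ→ℚ n → m ≡ n
  ℕ→ℚ-injective {m} {n} eq = ℤ.+-injective (cong ↥_ (trans (sym (ℕ→ℚ-mkℚ m)) (trans eq (ℕ→ℚ-mkℚ n))))

  ℕ→ℚ-nonNeg : ∀ n → 0ℚ ≤ ℕ→ℚ n
  ℕ→ℚ-nonNeg n rewrite ℕ→ℚ-mkℚ n = nonNegative⁻¹ _

  ℕ→ℚ-mono-< : ∀ {m n} → m ℕ.< n → ℕ→ℚ m < ℕ→ℚ n
  ℕ→ℚ-mono-< {m} {n} m<n rewrite ℕ→ℚ-mkℚ m | ℕ→ℚ-mkℚ n =
    *<* (subst₂ ℤ._<_ (sym (ℤ.*-identityʳ (+ m))) (sym (ℤ.*-identityʳ (+ n))) (ℤ.+<+ m<n))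

  -- Polynomial expressions over ℕ, evaluated in ℕ and in ℚ: ℕ→ℚ-⟦⟧ carries
  -- (in)equalities between natural numbers over to the rational side.
  infixl 6 _⊕_
  infixl 7 _⊗_

  data Expr : Set where
    ⌜_⌝     : ℕ → Expr
    _⊕_ _⊗_ : Expr → Expr → Expr

  ⟦_⟧ℕ : Expr → ℕ
  ⟦ ⌜ n ⌝ ⟧ℕ  = n
  ⟦ e ⊕ e′ ⟧ℕ = ⟦ e ⟧ℕ ℕ.+ ⟦ e′ ⟧ℕ
  ⟦ e ⊗ e′ ⟧ℕ = ⟦ e ⟧ℕ ℕ.* ⟦ e′ ⟧ℕ

  ⟦_⟧ : Expr → ℚ
  ⟦ ⌜ n ⌝ ⟧  = ℕ→ℚ n
  ⟦ e ⊕ e′ ⟧ = ⟦ e ⟧ + ⟦ e′ ⟧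
  ⟦ e ⊗ e′ ⟧ = ⟦ e ⟧ * ⟦ e′ ⟧

  ℕ→ℚ-⟦⟧ : ∀ e → ℕ→ℚ ⟦ e ⟧ℕ ≡ ⟦ e ⟧
  ℕ→ℚ-⟦⟧ ⌜ n ⌝    = refl
  ℕ→ℚ-⟦⟧ (e ⊕ e′) = trans (ℕ→ℚ-+ ⟦ e ⟧ℕ ⟦ e′ ⟧ℕ) (cong₂ _+_ (ℕ→ℚ-⟦⟧ e) (ℕ→ℚ-⟦⟧ e′))
  ℕ→ℚ-⟦⟧ (e ⊗ e′) = trans (ℕ→ℚ-* ⟦ e ⟧ℕ ⟦ e′ ⟧ℕ) (cong₂ _*_ (ℕ→ℚ-⟦⟧ e) (ℕ→ℚ-⟦⟧ e′))

  ⟦⟧-injective : ∀ e e′ → ⟦ e ⟧ ≡ ⟦ e′ ⟧ → ⟦ e ⟧ℕ ≡ ⟦ e′ ⟧ℕ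
  ⟦⟧-injective e e′ eq = ℕ→ℚ-injective (trans (ℕ→ℚ-⟦⟧ e) (trans eq (sym (ℕ→ℚ-⟦⟧ e′))))

  ⟦⟧-≢0 : ∀ e → ⟦ e ⟧ℕ ≢ 0 → ⟦ e ⟧ ≢ 0ℚ
  ⟦⟧-≢0 e ≢0 eq = ≢0 (⟦⟧-injective e ⌜ 0 ⌝ eq)

  ⟦⟧-nonNeg : ∀ e → 0ℚ ≤ ⟦ e ⟧
  ⟦⟧-nonNeg e = subst (0ℚ ≤_) (ℕ→ℚ-⟦⟧ e) (ℕ→ℚ-nonNeg ⟦ e ⟧ℕ)

module NaturalInequalities where
  open import Data.Nat
  open import Data.Nat.Properties
  open import Relation.Binary.PropositionalEquality

  1+t<t*t : ∀ {t} → 2 ≤ t → 1 + t < t * t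
  1+t<t*t {t} 2≤t = begin-strict
    1 + t   <⟨ +-monoˡ-< t ≤-refl ⟩
    2 + t   ≤⟨ +-monoˡ-≤ t 2≤t ⟩
    t + t   ≡⟨ cong (t +_) (*-identityˡ t) ⟨
    2 * t   ≤⟨ *-monoˡ-≤ t 2≤t ⟩
    t * t   ∎
    where open ≤-Reasoning

  krein₁-gap : ∀ {s t α β} → s ≡ α + β → 1 ≤ α → α ≤ suc t → 2 ≤ t →
               (1 + β) * (α * α) * ((1 + t) * (1 + t)) < s * s * (t * t) * ((1 + t) * (1 + t)) + t * t * (β * β * β)
  krein₁-gap {s} {t} {α} {β} refl 1≤α α≤1+t 2≤t = begin-strict
    (1 + β) * (α * α) * Q       ≤⟨ *-monoˡ-≤ Q (*-mono-≤ (+-monoˡ-≤ β 1≤α) (*-mono-≤ (m≤m+n α β) α≤1+t)) ⟩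
    s * (s * (1 + t)) * Q       <⟨ *-monoˡ-< Q (*-monoʳ-< s (*-monoʳ-< s (1+t<t*t 2≤t))) ⟩
    s * (s * (t * t)) * Q       ≡⟨ cong (_* Q) (*-assoc s s (t * t)) ⟨
    s * s * (t * t) * Q         ≤⟨ m≤m+n _ _ ⟩
    s * s * (t * t) * Q + t * t * (β * β * β) ∎
    where
    open ≤-Reasoning
    Q : ℕ
    Q = (1 + t) * (1 + t)
    instance
      s-nonZero : NonZero s
      s-nonZero = >-nonZero (≤-trans 1≤α (m≤m+n α β))

  s*s≤t : ∀ {s t α x} → 1 ≤ α → 1 ≤ t → s * s * x + t * (α * α) ≡ (1 + t) * x → s * s ≤ t
  s*s≤t {s} {t} {α} {x} 1≤α 1≤t eq = ≮⇒≥ λ t<s*s → <-irrefl (sym eq) (begin-strict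
    (1 + t) * x              ≤⟨ *-monoˡ-≤ x t<s*s ⟩
    s * s * x                <⟨ m<m+n (s * s * x) (*-mono-≤ 1≤t (*-mono-≤ 1≤α 1≤α)) ⟩
    s * s * x + t * (α * α)  ∎)
    where open ≤-Reasoning

module CollinearityScheme where
  open RationalArithmetic
  open NaturalEmbedding
  open NaturalInequalities
  open import Defs
  open import Data.Fin using (Fin; zero; suc)
  open import Data.Nat as ℕ using (ℕ)
  import Data.Nat.Properties as ℕ
  open import Data.Rational
  open import Data.Rational.Properties
  open import Data.Product using (Σ; _×_; _,_)
  open import Function using (_⇔_; mk⇔; Equivalence; _∘_)
  open import Function.Construct.Composition using (_⇔-∘_)
  open import Relation.Binary.PropositionalEquality
  open import Tactic.RingSolver using (solve-∀)

  -- β stands for s - α, so that the eigenvalue s - α and the factor s + 1 - α of k₂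
  -- become images of natural numbers.
  module Krein {s t α β N : ℕ} (s≡α+β : s ≡ α ℕ.+ β) (2≤s : 2 ℕ.≤ s) (2≤t : 2 ℕ.≤ t) (1≤α : 1 ℕ.≤ α) (N≢0 : N ≢ 0) where
    open Scheme s t α N
    open ≡-Reasoning

    B X W : ℚ
    B = ℕ→ℚ β
    X = S + 1ℚ - A
    W = S * T * X

    k₁ k₂ : ℚ
    k₁ = k (suc zero)
    k₂ = k (suc (suc zero))

    x̂ : Expr
    x̂ = ⌜ 1 ⌝ ⊕ ⌜ β ⌝

    S≡A+B : S ≡ A + B
    S≡A+B = trans (cong ℕ→ℚ s≡α+β) (ℕ→ℚ-+ α β)

    X≡1+B : X ≡ 1ℚ + B
    X≡1+B = trans (cong (λ S′ → S′ + 1ℚ - A) S≡A+B) (cancel A B)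
      where cancel : ∀ A B → A + B + 1ℚ - A ≡ 1ℚ + B
            cancel = solve-∀ ringℚ

    S-A≡B : S - A ≡ B
    S-A≡B = trans (cong (_- A) S≡A+B) (cancel A B)
      where cancel : ∀ A B → A + B - A ≡ B
            cancel = solve-∀ ringℚ

    S≢0 : S ≢ 0ℚ
    S≢0 = ⟦⟧-≢0 ⌜ s ⌝ (ℕ.m<n⇒n≢0 2≤s)

    T≢0 : T ≢ 0ℚ
    T≢0 = ⟦⟧-≢0 ⌜ t ⌝ (ℕ.m<n⇒n≢0 2≤t)

    A≢0 : A ≢ 0ℚ
    A≢0 = ⟦⟧-≢0 ⌜ α ⌝ (ℕ.m<n⇒n≢0 1≤α)

    Ω≢0 : Ω ≢ 0ℚ
    Ω≢0 = ⟦⟧-≢0 ⌜ N ⌝ N≢0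

    T+1≢0 : T + 1ℚ ≢ 0ℚ
    T+1≢0 = ⟦⟧-≢0 (⌜ t ⌝ ⊕ ⌜ 1 ⌝) (ℕ.m+1+n≢0 t)

    S+1≢0 : S + 1ℚ ≢ 0ℚ
    S+1≢0 = ⟦⟧-≢0 (⌜ s ⌝ ⊕ ⌜ 1 ⌝) (ℕ.m+1+n≢0 s)

    S-1≢0 : S - 1ℚ ≢ 0ℚ
    S-1≢0 S-1≡0 = ℕ.>⇒≢ 2≤s (ℕ→ℚ-injective {s} {1} (x-y≡0⇒x≡y S-1≡0))

    X≢0 : X ≢ 0ℚ
    X≢0 = subst (_≢ 0ℚ) (sym X≡1+B) (⟦⟧-≢0 x̂ λ ())

    W≢0 : W ≢ 0ℚ
    W≢0 = x*y≢0 (x*y≢0 S≢0 T≢0) X≢0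

    k₁≢0 : k₁ ≢ 0ℚ
    k₁≢0 = x*y≢0 S≢0 T+1≢0

    k₂*A≡W : k₂ * A ≡ W
    k₂*A≡W = begin
      S * T ÷? A * X * A    ≡⟨ swap (S * T ÷? A) X A ⟩
      S * T ÷? A * A * X    ≡⟨ cong (_* X) (x÷?y*y≡x (S * T) A≢0) ⟩
      S * T * X             ∎
      where swap : ∀ a b c → a * b * c ≡ a * c * b
            swap = solve-∀ ringℚ

    k₂≢0 : k₂ ≢ 0ℚ
    k₂≢0 k₂≡0 = W≢0 (trans (sym k₂*A≡W) (trans (cong (_* A) k₂≡0) (*-zeroˡ A)))

    D : ℚ
    D = k₁ * W

    D≢0 : D ≢ 0ℚ
    D≢0 = x*y≢0 k₁≢0 W≢0

    σ-cleared : ∀ x y → (1ℚ + x * x ÷? k₁ + y * y ÷? k₂) * D ≡ D + x * x * W + y * y * k₁ * A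
    σ-cleared x y = begin
      σ-row * (k₁ * W)            ≡⟨ cong (λ w → σ-row * (k₁ * w)) k₂*A≡W ⟨
      σ-row * (k₁ * (k₂ * A))     ≡⟨ fractions-cleared 1ℚ (x * x) (y * y) A k₁≢0 k₂≢0 ⟩
      1ℚ * (k₁ * (k₂ * A)) + x * x * (k₂ * A) + y * y * k₁ * A
        ≡⟨ cong (λ w → 1ℚ * (k₁ * w) + x * x * w + y * y * k₁ * A) k₂*A≡W ⟩
      1ℚ * D + x * x * W + y * y * k₁ * A                    ≡⟨ cong (λ d → d + x * x * W + y * y * k₁ * A) (*-identityˡ D) ⟩
      D + x * x * W + y * y * k₁ * A                         ∎
      where σ-row : ℚ
            σ-row = 1ℚ + x * x ÷? k₁ + y * y ÷? k₂

    τ-cleared : ∀ x y → (1ℚ + x * x * x ÷? (k₁ * k₁) + y * y * y ÷? (k₂ * k₂)) * (D * D) ≡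
                        D * D + x * x * x * (W * W) + y * y * y * (k₁ * k₁) * (A * A)
    τ-cleared x y = begin
      τ-row * (D * D)                                        ≡⟨ cong (τ-row *_) D*D-expanded ⟩
      τ-row * (k₁ * k₁ * (k₂ * k₂ * (A * A)))
        ≡⟨ fractions-cleared 1ℚ (x * x * x) (y * y * y) (A * A) (x*y≢0 k₁≢0 k₁≢0) (x*y≢0 k₂≢0 k₂≢0) ⟩
      1ℚ * (k₁ * k₁ * (k₂ * k₂ * (A * A))) + x * x * x * (k₂ * k₂ * (A * A)) + y * y * y * (k₁ * k₁) * (A * A)
        ≡⟨ cong₂ (λ d w → d + x * x * x * w + y * y * y * (k₁ * k₁) * (A * A)) (trans (*-identityˡ _) (sym D*D-expanded)) k₂²A²≡W² ⟩
      D * D + x * x * x * (W * W) + y * y * y * (k₁ * k₁) * (A * A) ∎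
      where
      τ-row : ℚ
      τ-row = 1ℚ + x * x * x ÷? (k₁ * k₁) + y * y * y ÷? (k₂ * k₂)
      square-product : ∀ a b → a * a * (b * b) ≡ (a * b) * (a * b)
      square-product = solve-∀ ringℚ
      k₂²A²≡W² : k₂ * k₂ * (A * A) ≡ W * W
      k₂²A²≡W² = trans (square-product k₂ A) (cong (λ w → w * w) k₂*A≡W)
      D*D-expanded : D * D ≡ k₁ * k₁ * (k₂ * k₂ * (A * A))
      D*D-expanded = trans (sym (square-product k₁ W)) (cong (k₁ * k₁ *_) (sym k₂²A²≡W²))

    σ : Fin 3 → ℚ
    σ i = sum3 (λ ℓ → P i ℓ * P i ℓ ÷? k ℓ)

    τ : Fin 3 → ℚ
    τ i = sum3 (λ ℓ → P i ℓ * P i ℓ * P i ℓ ÷? (k ℓ * k ℓ))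

    krein≡0⇔τ≡0 : ∀ i → σ i ≢ 0ℚ → q i i i ≡ 0ℚ ⇔ τ i ≡ 0ℚ
    krein≡0⇔τ≡0 i σ≢0 = mk⇔ (x*y≡0⇒y≡0 m²/Ω≢0) λ τ≡0 → trans (cong (m i * m i ÷? Ω *_) τ≡0) (*-zeroʳ (m i * m i ÷? Ω))
      where
      m≢0 : m i ≢ 0ℚ
      m≢0 = x÷?y≢0 Ω≢0 σ≢0
      m²/Ω≢0 : m i * m i ÷? Ω ≢ 0ℚ
      m²/Ω≢0 = x÷?y≢0 (x*y≢0 m≢0 m≢0) Ω≢0

    x*D≡D+⟦e⟧⇒x≢0 : ∀ {x} e → x * D ≡ D + ⟦ e ⟧ → x ≢ 0ℚ
    x*D≡D+⟦e⟧⇒x≢0 {x} e xD≡D+e x≡0 = ⟦⟧-≢0 (d ⊕ e) d+e≢0 (begin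
      ⟦ d ⟧ + ⟦ e ⟧   ≡⟨ cong (_+ ⟦ e ⟧) D≡⟦d⟧ ⟨
      D + ⟦ e ⟧       ≡⟨ xD≡D+e ⟨
      x * D           ≡⟨ cong (_* D) x≡0 ⟩
      0ℚ * D          ≡⟨ *-zeroˡ D ⟩
      0ℚ              ∎)
      where
      d : Expr
      d = ⌜ s ⌝ ⊗ (⌜ t ⌝ ⊕ ⌜ 1 ⌝) ⊗ (⌜ s ⌝ ⊗ ⌜ t ⌝ ⊗ x̂)
      D≡⟦d⟧ : D ≡ ⟦ d ⟧
      D≡⟦d⟧ = cong (λ x → k₁ * (S * T * x)) X≡1+B
      d+e≢0 : ⟦ d ⟧ℕ ℕ.+ ⟦ e ⟧ℕ ≢ 0
      d+e≢0 d+e≡0 = D≢0 (trans D≡⟦d⟧ (trans (sym (ℕ→ℚ-⟦⟧ d)) (cong ℕ→ℚ (ℕ.m+n≡0⇒m≡0 ⟦ d ⟧ℕ d+e≡0))))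

    σ₁≢0 : σ (suc zero) ≢ 0ℚ
    σ₁≢0 = x*D≡D+⟦e⟧⇒x≢0 e₁ (begin
      σ (suc zero) * D                                                      ≡⟨ σ-cleared (S - A) (A - S - 1ℚ) ⟩
      D + (S - A) * (S - A) * W + (A - S - 1ℚ) * (A - S - 1ℚ) * k₁ * A     ≡⟨ regroup S T A D k₁ ⟩
      D + ((S - A) * (S - A) * (S * T * X) + X * X * k₁ * A)
        ≡⟨ cong₂ (λ b x → D + (b * b * (S * T * x) + x * x * k₁ * A)) S-A≡B X≡1+B ⟩
      D + ⟦ e₁ ⟧                                                            ∎)
      where
      e₁ : Expr
      e₁ = ⌜ β ⌝ ⊗ ⌜ β ⌝ ⊗ (⌜ s ⌝ ⊗ ⌜ t ⌝ ⊗ x̂) ⊕ x̂ ⊗ x̂ ⊗ (⌜ s ⌝ ⊗ (⌜ t ⌝ ⊕ ⌜ 1 ⌝)) ⊗ ⌜ α ⌝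
      regroup : ∀ S T A D k → D + (S - A) * (S - A) * (S * T * (S + 1ℚ - A)) + (A - S - 1ℚ) * (A - S - 1ℚ) * k * A ≡
                              D + ((S - A) * (S - A) * (S * T * (S + 1ℚ - A)) + (S + 1ℚ - A) * (S + 1ℚ - A) * k * A)
      regroup = solve-∀ ringℚ

    σ₂≢0 : σ (suc (suc zero)) ≢ 0ℚ
    σ₂≢0 = x*D≡D+⟦e⟧⇒x≢0 e₂ (begin
      σ (suc (suc zero)) * D                                                ≡⟨ σ-cleared (0ℚ - T - 1ℚ) T ⟩
      D + (0ℚ - T - 1ℚ) * (0ℚ - T - 1ℚ) * W + T * T * k₁ * A               ≡⟨ regroup T W D (T * T * k₁ * A) ⟩
      D + ((T + 1ℚ) * (T + 1ℚ) * (S * T * X) + T * T * k₁ * A)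
        ≡⟨ cong (λ x → D + ((T + 1ℚ) * (T + 1ℚ) * (S * T * x) + T * T * k₁ * A)) X≡1+B ⟩
      D + ⟦ e₂ ⟧                                                            ∎)
      where
      e₂ : Expr
      e₂ = (⌜ t ⌝ ⊕ ⌜ 1 ⌝) ⊗ (⌜ t ⌝ ⊕ ⌜ 1 ⌝) ⊗ (⌜ s ⌝ ⊗ ⌜ t ⌝ ⊗ x̂) ⊕ ⌜ t ⌝ ⊗ ⌜ t ⌝ ⊗ (⌜ s ⌝ ⊗ (⌜ t ⌝ ⊕ ⌜ 1 ⌝)) ⊗ ⌜ α ⌝
      regroup : ∀ T W D z → D + (0ℚ - T - 1ℚ) * (0ℚ - T - 1ℚ) * W + z ≡ D + ((T + 1ℚ) * (T + 1ℚ) * W + z)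
      regroup = solve-∀ ringℚ

    τ₁≢0 : α ℕ.≤ ℕ.suc t → τ (suc zero) ≢ 0ℚ
    τ₁≢0 α≤1+t τ₁≡0 = ℕ.<⇒≢ (krein₁-gap s≡α+β 1≤α α≤1+t 2≤t) (sym (⟦⟧-injective R L (x-y≡0⇒x≡y R-L≡0)))
      where
      L R : Expr
      L = x̂ ⊗ (⌜ α ⌝ ⊗ ⌜ α ⌝) ⊗ ((⌜ 1 ⌝ ⊕ ⌜ t ⌝) ⊗ (⌜ 1 ⌝ ⊕ ⌜ t ⌝))
      R = ⌜ s ⌝ ⊗ ⌜ s ⌝ ⊗ (⌜ t ⌝ ⊗ ⌜ t ⌝) ⊗ ((⌜ 1 ⌝ ⊕ ⌜ t ⌝) ⊗ (⌜ 1 ⌝ ⊕ ⌜ t ⌝)) ⊕ ⌜ t ⌝ ⊗ ⌜ t ⌝ ⊗ (⌜ β ⌝ ⊗ ⌜ β ⌝ ⊗ ⌜ β ⌝)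
      factor : ∀ S T A → let X = S + 1ℚ - A; W = S * T * X; k = S * (T + 1ℚ); D = k * W in
        D * D + (S - A) * (S - A) * (S - A) * (W * W) + (A - S - 1ℚ) * (A - S - 1ℚ) * (A - S - 1ℚ) * (k * k) * (A * A) ≡
        S * S * (X * X) * (S * S * (T * T) * ((1ℚ + T) * (1ℚ + T)) + T * T * ((S - A) * (S - A) * (S - A)) - X * (A * A) * ((1ℚ + T) * (1ℚ + T)))
      factor = solve-∀ ringℚ
      τ₁-factored : τ (suc zero) * (D * D) ≡ S * S * (X * X) * (⟦ R ⟧ - ⟦ L ⟧)
      τ₁-factored = begin
        τ (suc zero) * (D * D)
          ≡⟨ τ-cleared (S - A) (A - S - 1ℚ) ⟩
        D * D + (S - A) * (S - A) * (S - A) * (W * W) + (A - S - 1ℚ) * (A - S - 1ℚ) * (A - S - 1ℚ) * (k₁ * k₁) * (A * A)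
          ≡⟨ factor S T A ⟩
        S * S * (X * X) * (S * S * (T * T) * ((1ℚ + T) * (1ℚ + T)) + T * T * ((S - A) * (S - A) * (S - A)) - X * (A * A) * ((1ℚ + T) * (1ℚ + T)))
          ≡⟨ cong₂ (λ b x → S * S * (X * X) * (S * S * (T * T) * ((1ℚ + T) * (1ℚ + T)) + T * T * (b * b * b) - x * (A * A) * ((1ℚ + T) * (1ℚ + T)))) S-A≡B X≡1+B ⟩
        S * S * (X * X) * (⟦ R ⟧ - ⟦ L ⟧) ∎
      R-L≡0 : ⟦ R ⟧ - ⟦ L ⟧ ≡ 0ℚ
      R-L≡0 = x*y≡0⇒y≡0 (x*y≢0 (x*y≢0 S≢0 S≢0) (x*y≢0 X≢0 X≢0))
        (trans (sym τ₁-factored) (trans (cong (_* (D * D)) τ₁≡0) (*-zeroˡ (D * D))))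

    c g : ℚ
    c = S * S - T - 1ℚ
    g = c * (X * X) + T * (A * A)

    τ₂≡0⇔g≡0 : τ (suc (suc zero)) ≡ 0ℚ ⇔ g ≡ 0ℚ
    τ₂≡0⇔g≡0 = mk⇔
      (λ τ₂≡0 → x*y≡0⇒y≡0 K≢0 (trans (sym τ₂-factored) (trans (cong (_* (D * D)) τ₂≡0) (*-zeroˡ (D * D)))))
      (λ g≡0 → x*y≡0⇒y≡0 (x*y≢0 D≢0 D≢0)
        (trans (*-comm (D * D) _) (trans τ₂-factored (trans (cong (K *_) g≡0) (*-zeroʳ K)))))
      where
      K : ℚ
      K = S * S * (T * T) * ((T + 1ℚ) * (T + 1ℚ))
      K≢0 : K ≢ 0ℚ
      K≢0 = x*y≢0 (x*y≢0 (x*y≢0 S≢0 S≢0) (x*y≢0 T≢0 T≢0)) (x*y≢0 T+1≢0 T+1≢0)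
      factor : ∀ S T A → let X = S + 1ℚ - A; W = S * T * X; k = S * (T + 1ℚ); D = k * W in
        D * D + (0ℚ - T - 1ℚ) * (0ℚ - T - 1ℚ) * (0ℚ - T - 1ℚ) * (W * W) + T * T * T * (k * k) * (A * A) ≡
        S * S * (T * T) * ((T + 1ℚ) * (T + 1ℚ)) * ((S * S - T - 1ℚ) * (X * X) + T * (A * A))
      factor = solve-∀ ringℚ
      τ₂-factored : τ (suc (suc zero)) * (D * D) ≡ K * g
      τ₂-factored = trans (τ-cleared (0ℚ - T - 1ℚ) T) (factor S T A)

    g≡0⇒s*s≤t : g ≡ 0ℚ → s ℕ.* s ℕ.≤ t
    g≡0⇒s*s≤t g≡0 = s*s≤t {s} 1≤α (ℕ.<⇒≤ 2≤t) (⟦⟧-injective lhs rhs (x-y≡0⇒x≡y (begin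
      ⟦ lhs ⟧ - ⟦ rhs ⟧                                         ≡⟨ cong (λ x → S * S * (x * x) + T * (A * A) - (1ℚ + T) * (x * x)) X≡1+B ⟨
      S * S * (X * X) + T * (A * A) - (1ℚ + T) * (X * X)         ≡⟨ expand S T X A ⟨
      g                                                         ≡⟨ g≡0 ⟩
      0ℚ                                                        ∎)))
      where
      lhs rhs : Expr
      lhs = ⌜ s ⌝ ⊗ ⌜ s ⌝ ⊗ (x̂ ⊗ x̂) ⊕ ⌜ t ⌝ ⊗ (⌜ α ⌝ ⊗ ⌜ α ⌝)
      rhs = (⌜ 1 ⌝ ⊕ ⌜ t ⌝) ⊗ (x̂ ⊗ x̂)
      expand : ∀ S T X A → (S * S - T - 1ℚ) * (X * X) + T * (A * A) ≡ S * S * (X * X) + T * (A * A) - (1ℚ + T) * (X * X)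
      expand = solve-∀ ringℚ

    r₀ : ℚ
    r₀ = (S - 1ℚ) * A - c

    g≡0⇔r₀²≡T[T+1-S²] : g ≡ 0ℚ ⇔ r₀ * r₀ ≡ T * (T + 1ℚ - S * S)
    g≡0⇔r₀²≡T[T+1-S²] = mk⇔
      (λ g≡0 → x-y≡0⇒x≡y (x*y≡0⇒y≡0 S+1≢0 (trans (sym completed) (trans (cong ((S - 1ℚ) *_) g≡0) (*-zeroʳ (S - 1ℚ))))))
      (λ r₀²≡ → x*y≡0⇒y≡0 S-1≢0 (begin
        (S - 1ℚ) * g                                      ≡⟨ completed ⟩
        (S + 1ℚ) * (r₀ * r₀ - T * (T + 1ℚ - S * S))       ≡⟨ cong (λ z → (S + 1ℚ) * (z - T * (T + 1ℚ - S * S))) r₀²≡ ⟩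
        (S + 1ℚ) * (T * (T + 1ℚ - S * S) - T * (T + 1ℚ - S * S)) ≡⟨ cong ((S + 1ℚ) *_) (+-inverseʳ (T * (T + 1ℚ - S * S))) ⟩
        (S + 1ℚ) * 0ℚ                                     ≡⟨ *-zeroʳ (S + 1ℚ) ⟩
        0ℚ                                                ∎))
      where
      complete-square : ∀ S T A → let X = S + 1ℚ - A; c = S * S - T - 1ℚ; r = (S - 1ℚ) * A - c in
        (S - 1ℚ) * (c * (X * X) + T * (A * A)) ≡ (S + 1ℚ) * (r * r - T * (T + 1ℚ - S * S))
      complete-square = solve-∀ ringℚ
      completed : (S - 1ℚ) * g ≡ (S + 1ℚ) * (r₀ * r₀ - T * (T + 1ℚ - S * S))
      completed = complete-square S T A

    α-formula⇔r≡r₀ : ∀ r → A ≡ (c + r) ÷? (S - 1ℚ) ⇔ r ≡ r₀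
    α-formula⇔r≡r₀ r = mk⇔
      (λ A≡ → begin
        r                            ≡⟨ add-sub c r ⟩
        c + r - c                    ≡⟨ cong (_- c) (x÷?y*y≡x (c + r) S-1≢0) ⟨
        (c + r) ÷? (S - 1ℚ) * (S - 1ℚ) - c ≡⟨ cong (λ a → a * (S - 1ℚ) - c) A≡ ⟨
        A * (S - 1ℚ) - c             ≡⟨ cong (_- c) (*-comm A (S - 1ℚ)) ⟩
        r₀                           ∎)
      (λ r≡r₀ → x*z≡y⇒x≡y÷?z S-1≢0 (begin
        A * (S - 1ℚ)                 ≡⟨ sub-add A (S - 1ℚ) c ⟩
        c + r₀                       ≡⟨ cong (c +_) r≡r₀ ⟨
        c + r                        ∎))
      where
      add-sub : ∀ c r → r ≡ c + r - c
      add-sub = solve-∀ ringℚ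
      sub-add : ∀ A u c → A * u ≡ c + (u * A - c)
      sub-add = solve-∀ ringℚ

    r₀≥0 : s ℕ.* s ℕ.≤ t → 0ℚ ≤ r₀
    r₀≥0 s*s≤t with s′ , 1+s′≡s ← ℕ.m≤n⇒∃[o]m+o≡n (ℕ.<⇒≤ 2≤s) | δ , s*s+δ≡t ← ℕ.m≤n⇒∃[o]m+o≡n s*s≤t =
      subst (0ℚ ≤_) (sym r₀-expanded) (⟦⟧-nonNeg (⌜ s′ ⌝ ⊗ ⌜ α ⌝ ⊕ ⌜ δ ⌝ ⊕ ⌜ 1 ⌝))
      where
      S-1≡S′ : S - 1ℚ ≡ ℕ→ℚ s′
      S-1≡S′ = begin
        S - 1ℚ                ≡⟨ cong (λ n → ℕ→ℚ n - 1ℚ) 1+s′≡s ⟨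
        ℕ→ℚ (1 ℕ.+ s′) - 1ℚ   ≡⟨ cong (_- 1ℚ) (ℕ→ℚ-+ 1 s′) ⟩
        1ℚ + ℕ→ℚ s′ - 1ℚ      ≡⟨ cancel (ℕ→ℚ s′) ⟩
        ℕ→ℚ s′                ∎
        where cancel : ∀ x → 1ℚ + x - 1ℚ ≡ x
              cancel = solve-∀ ringℚ
      T≡S*S+Δ : T ≡ S * S + ℕ→ℚ δ
      T≡S*S+Δ = begin
        T                        ≡⟨ cong ℕ→ℚ s*s+δ≡t ⟨
        ℕ→ℚ (s ℕ.* s ℕ.+ δ)      ≡⟨ ℕ→ℚ-+ (s ℕ.* s) δ ⟩
        ℕ→ℚ (s ℕ.* s) + ℕ→ℚ δ    ≡⟨ cong (_+ ℕ→ℚ δ) (ℕ→ℚ-* s s) ⟩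
        S * S + ℕ→ℚ δ            ∎
      simplify : ∀ u A Q Δ → u * A - (Q - (Q + Δ) - 1ℚ) ≡ u * A + Δ + 1ℚ
      simplify = solve-∀ ringℚ
      r₀-expanded : r₀ ≡ ℕ→ℚ s′ * A + ℕ→ℚ δ + 1ℚ
      r₀-expanded = trans (cong₂ (λ u T′ → u * A - (S * S - T′ - 1ℚ)) S-1≡S′ T≡S*S+Δ) (simplify (ℕ→ℚ s′) A (S * S) (ℕ→ℚ δ))

    AlphaFormula : Set
    AlphaFormula = Σ ℚ λ r → (0ℚ ≤ r) × (r * r ≡ T * (T + 1ℚ - S * S)) × (A ≡ (c + r) ÷? (S - 1ℚ))

    g≡0⇒AlphaFormula : g ≡ 0ℚ → AlphaFormula
    g≡0⇒AlphaFormula g≡0 =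
      r₀ , r₀≥0 (g≡0⇒s*s≤t g≡0) , Equivalence.to g≡0⇔r₀²≡T[T+1-S²] g≡0 , Equivalence.from (α-formula⇔r≡r₀ r₀) refl

    AlphaFormula⇒g≡0 : AlphaFormula → g ≡ 0ℚ
    AlphaFormula⇒g≡0 (r , _ , r²≡ , A≡) =
      Equivalence.from g≡0⇔r₀²≡T[T+1-S²] (subst (λ x → x * x ≡ _) (Equivalence.to (α-formula⇔r≡r₀ r) A≡) r²≡)

    AlphaFormula⇒[α≡1⇒t≡s*s] : AlphaFormula → α ≡ 1 → t ≡ s ℕ.* s
    AlphaFormula⇒[α≡1⇒t≡s*s] (r , _ , r²≡ , A≡) α≡1 = sym (ℕ→ℚ-injective (trans (ℕ→ℚ-* s s) (x-y≡0⇒x≡y S*S-T≡0)))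
      where
      A≡1 : A ≡ 1ℚ
      A≡1 = cong ℕ→ℚ α≡1
      factor : ∀ S T → let r = (S - 1ℚ) * 1ℚ - (S * S - T - 1ℚ) in
        (S - 1ℚ) * (S - 1ℚ) * (S * S - T) ≡ r * r - T * (T + 1ℚ - S * S)
      factor = solve-∀ ringℚ
      S*S-T≡0 : S * S - T ≡ 0ℚ
      S*S-T≡0 = x*y≡0⇒y≡0 (x*y≢0 S-1≢0 S-1≢0) (begin
        (S - 1ℚ) * (S - 1ℚ) * (S * S - T)                    ≡⟨ factor S T ⟩
        ((S - 1ℚ) * 1ℚ - c) * ((S - 1ℚ) * 1ℚ - c) - T * (T + 1ℚ - S * S)
          ≡⟨ cong (λ a → ((S - 1ℚ) * a - c) * ((S - 1ℚ) * a - c) - T * (T + 1ℚ - S * S)) A≡1 ⟨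
        r₀ * r₀ - T * (T + 1ℚ - S * S)                       ≡⟨ cong (λ x → x * x - T * (T + 1ℚ - S * S)) (Equivalence.to (α-formula⇔r≡r₀ r) A≡) ⟨
        r * r - T * (T + 1ℚ - S * S)                         ≡⟨ cong (_- T * (T + 1ℚ - S * S)) r²≡ ⟩
        T * (T + 1ℚ - S * S) - T * (T + 1ℚ - S * S)          ≡⟨ +-inverseʳ (T * (T + 1ℚ - S * S)) ⟩
        0ℚ                                                   ∎)

    AlphaFormula⇒[t≡s*s⇒α≡1] : AlphaFormula → t ≡ s ℕ.* s → α ≡ 1
    AlphaFormula⇒[t≡s*s⇒α≡1] (r , r≥0 , r²≡ , A≡) t≡s*s = ℕ→ℚ-injective {α} {1} (x-y≡0⇒x≡y A-1≡0)
      where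
      T≡S*S : T ≡ S * S
      T≡S*S = trans (cong ℕ→ℚ t≡s*s) (ℕ→ℚ-* s s)
      r+S≢0 : r + S ≢ 0ℚ
      r+S≢0 = ≢-sym (<⇒≢ (+-mono-≤-< r≥0 (ℕ→ℚ-mono-< {0} {s} (ℕ.<-trans ℕ.z<s 2≤s))))
      difference-of-squares : ∀ r S → (r + S) * (r - S) ≡ r * r - S * S * (S * S + 1ℚ - S * S)
      difference-of-squares = solve-∀ ringℚ
      r≡S : r ≡ S
      r≡S = x-y≡0⇒x≡y (x*y≡0⇒y≡0 r+S≢0 (begin
        (r + S) * (r - S)                                   ≡⟨ difference-of-squares r S ⟩
        r * r - S * S * (S * S + 1ℚ - S * S)                ≡⟨ cong (λ T′ → r * r - T′ * (T′ + 1ℚ - S * S)) T≡S*S ⟨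
        r * r - T * (T + 1ℚ - S * S)                        ≡⟨ cong (_- T * (T + 1ℚ - S * S)) r²≡ ⟩
        T * (T + 1ℚ - S * S) - T * (T + 1ℚ - S * S)         ≡⟨ +-inverseʳ (T * (T + 1ℚ - S * S)) ⟩
        0ℚ                                                  ∎))
      factor : ∀ S A → (S - 1ℚ) * (A - 1ℚ) ≡ (S - 1ℚ) * A - (S * S - S * S - 1ℚ) - S
      factor = solve-∀ ringℚ
      A-1≡0 : A - 1ℚ ≡ 0ℚ
      A-1≡0 = x*y≡0⇒y≡0 S-1≢0 (begin
        (S - 1ℚ) * (A - 1ℚ)                                 ≡⟨ factor S A ⟩
        (S - 1ℚ) * A - (S * S - S * S - 1ℚ) - S             ≡⟨ cong (λ T′ → (S - 1ℚ) * A - (S * S - T′ - 1ℚ) - S) T≡S*S ⟨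
        r₀ - S                                              ≡⟨ cong (_- S) (trans (sym (Equivalence.to (α-formula⇔r≡r₀ r) A≡)) r≡S) ⟩
        S - S                                               ≡⟨ +-inverseʳ S ⟩
        0ℚ                                                  ∎)

    krein₁₁₁≢0 : α ℕ.≤ ℕ.suc t → q (suc zero) (suc zero) (suc zero) ≢ 0ℚ
    krein₁₁₁≢0 α≤1+t = τ₁≢0 α≤1+t ∘ Equivalence.to (krein≡0⇔τ≡0 (suc zero) σ₁≢0)

    krein₂₂₂≡0⇔g≡0 : q (suc (suc zero)) (suc (suc zero)) (suc (suc zero)) ≡ 0ℚ ⇔ g ≡ 0ℚ
    krein₂₂₂≡0⇔g≡0 = τ₂≡0⇔g≡0 ⇔-∘ krein≡0⇔τ≡0 (suc (suc zero)) σ₂≢0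

open import Defs
open import Data.Nat using (ℕ; _≤_; _*_)
open import Data.Fin using (Fin; zero; suc)
open import Data.Bool using (false)
open import Data.Product using (Σ; ∃; _×_; _,_)
open import Data.Rational using (ℚ; 0ℚ; 1ℚ; _+_; _-_) renaming (_*_ to _*q_; _≤_ to _≤q_)
open import Relation.Binary.PropositionalEquality using (_≡_; _≢_)
open import Data.Nat.Properties using (<⇒≤; m+[n∸m]≡n)
open import Data.Product using (proj₂)
open import Data.Empty using (⊥-elim)
open import Function using (_∘_; Equivalence)
open import Relation.Binary.PropositionalEquality using (refl; sym)
open PartialGeometryBounds
open CollinearityScheme

theorem5p1 : ∀ {s t α : ℕ} → 2 ≤ s → 2 ≤ t → (Γ : PartialGeometry s t α) →
    -- the collinearity graph is not complete (2-class scheme)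
    (∃ λ p → ∃ λ q → PartialGeometry.collinear Γ p q ≡ false) →
    ∀ (i : Fin 3) → i ≢ zero →
    let S = ℕ→ℚ s
        T = ℕ→ℚ t
        Cond = (i ≡ suc (suc zero)) ×
               (Σ ℚ λ r → (0ℚ ≤q r) × (r *q r ≡ T *q (T + 1ℚ - S *q S)) ×
                 (ℕ→ℚ α ≡ (S *q S - T - 1ℚ + r) ÷? (S - 1ℚ))) ×
               (s * s ≤ t)
    in ((krein Γ i i i ≡ 0ℚ → Cond) × (Cond → krein Γ i i i ≡ 0ℚ)) ×
       (Cond → (α ≡ 1 → t ≡ s * s) × (t ≡ s * s → α ≡ 1))
theorem5p1 _ _ _ _ zero i≢0 = ⊥-elim (i≢0 refl)
theorem5p1 2≤s 2≤t Γ (p , q , p≁q) (suc zero) _ =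
  (⊥-elim ∘ krein₁₁₁≢0 (α≤1+t Γ (proj₂ (proj₂ (noncollinear⇒off-line Γ p≁q)))) , λ { (() , _) }) , λ { (() , _) }
  where open Krein (sym (m+[n∸m]≡n (α≤s Γ p≁q))) 2≤s 2≤t (1≤α Γ (<⇒≤ 2≤s) (<⇒≤ 2≤t)) (v≢0 Γ)
theorem5p1 2≤s 2≤t Γ (p , q , p≁q) (suc (suc zero)) _ =
  ( (λ q≡0 → let g≡0 = Equivalence.to krein₂₂₂≡0⇔g≡0 q≡0 in refl , g≡0⇒AlphaFormula g≡0 , g≡0⇒s*s≤t g≡0)
  , (λ { (_ , φ , _) → Equivalence.from krein₂₂₂≡0⇔g≡0 (AlphaFormula⇒g≡0 φ) }) )
  , λ { (_ , φ , _) → AlphaFormula⇒[α≡1⇒t≡s*s] φ , AlphaFormula⇒[t≡s*s⇒α≡1] φ }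
  where open Krein (sym (m+[n∸m]≡n (α≤s Γ p≁q))) 2≤s 2≤t (1≤α Γ (<⇒≤ 2≤s) (<⇒≤ 2≤t)) (v≢0 Γ)
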